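{- Let $t$ be a positive integer. There exists a degree sequence $d$ with a partition $(a,b)\in\mathrm{BP}(d)$, where $a=(a_1,\dots)$ and $b=(b_1,\dots)$ are non-increasing, such that $a_1\cdot b_1=\sum d/2+t+2$ and $(a,b)$ is not $t$-tot-bigraphic.
   Context: A degree sequence is a non-increasing sequence of positive integers with even sum. $\mathrm{BP}(d)$ is the set of pairs $(a,b)$ of complementary subsequences of $d$ with equal sums. Multigraphs are loopless (parallel edges allowed). For a multigraph $H=(V,E)$, $\mathrm{TotMult}(H)=|E|-|E'|$ with $E'$ the edge set of the underlying simple graph. $(a,b)$ is $t$-tot-bigraphic if there is a loopless multigraph $H$ with underlying bipartite graph with sides $A,B$, where the degree sequence of $A$ is $a$, that of $B$ is $b$, and $\mathrm{TotMult}(H)\le t$. -}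

module Defs where

open import Data.Nat using (ℕ; zero; suc; _+_; _*_; _∸_; _≤_)
open import Data.Nat.Divisibility using (_∣_)
open import Data.Fin using (Fin; zero; suc)
open import Data.List using (List; []; _∷_; length; lookup)
open import Data.Nat.ListAction using (sum)
open import Data.List.Relation.Unary.All using (All)
open import Data.List.Relation.Unary.Linked using (Linked)
open import Data.List.Relation.Ternary.Interleaving.Propositional using (Interleaving)
open import Data.Product using (Σ; _×_; ∃)
open import Relation.Binary.PropositionalEquality using (_≡_)

∑ : ∀ {n} → (Fin n → ℕ) → ℕ
∑ {zero}  f = 0
∑ {suc n} f = f zero + ∑ (λ i → f (suc i))

NonIncreasing : List ℕ → Set
NonIncreasing = Linked (λ x y → y ≤ x)

DegreeSequence : List ℕ → Set
DegreeSequence d = NonIncreasing d × All (λ x → 1 ≤ x) d × (2 ∣ sum d)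

-- (a , b) ∈ BP(d): a and b are complementary subsequences of d
-- (d is an interleaving of a and b) with equal sums.
BP : List ℕ → List ℕ → List ℕ → Set
BP d a b = Interleaving a b d × (sum a ≡ sum b)

-- A loopless multigraph whose underlying graph is bipartite with sides
-- A = {vertices of a} and B = {vertices of b} is given by its edge
-- multiplicities m i j between the i-th vertex of A and the j-th vertex of B.
BipMultigraph : ℕ → ℕ → Set
BipMultigraph p q = Fin p → Fin q → ℕ

degA : ∀ {p q} → BipMultigraph p q → Fin p → ℕ
degA m i = ∑ (λ j → m i j)

degB : ∀ {p q} → BipMultigraph p q → Fin q → ℕ
degB m j = ∑ (λ i → m i j)

-- TotMult(H) = |E| - |E'| : each pair joined by k ≥ 1 parallel edges
-- contributes k - 1 (one edge survives in the underlying simple graph).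
TotMult : ∀ {p q} → BipMultigraph p q → ℕ
TotMult m = ∑ (λ i → ∑ (λ j → m i j ∸ 1))

TotBigraphic : ℕ → List ℕ → List ℕ → Set
TotBigraphic t a b =
  Σ (BipMultigraph (length a) (length b)) λ m →
    (∀ i → degA m i ≡ lookup a i) ×
    (∀ j → degB m j ≡ lookup b j) ×
    (TotMult m ≤ t)

{-# OPTIONS --safe #-}
-- Take a = b = (t+2, …, t+2) with t+1 entries and d their interleaving.  A vertex
-- of A must have degree t+2 but has only t+1 possible neighbours, so some pair at
-- it carries a parallel edge; the t+1 vertices of A thus force TotMult ≥ t+1.
-- Meanwhile a₁ b₁ = (t+2)² = (t+1)(t+2) + t + 2 = ∑ d / 2 + t + 2.
module Submission where

open import Defs
open import Data.Nat using (ℕ; _+_; _*_; _/_; _≤_)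
open import Data.List using (List; _∷_)
open import Data.Nat.ListAction using (sum)
open import Data.Product using (Σ; _×_; ∃)
open import Relation.Binary.PropositionalEquality using (_≡_)
open import Relation.Nullary using (¬_)

open import Data.Nat using (zero; suc; _∸_; _<_; z≤n; s≤s)
open import Data.Nat.Properties
open import Data.Nat.DivMod using (m*n/n≡m)
open import Data.Nat.Divisibility using (divides)
open import Data.Nat.Solver using (module +-*-Solver)
open import Data.Fin using (Fin; zero; suc)
open import Data.List using (replicate; length)
open import Data.List.Properties using (length-replicate)
open import Data.List.Membership.Propositional.Properties using (∈-lookup)
open import Data.List.Relation.Unary.All as All using (All)
open import Data.List.Relation.Unary.All.Properties using (replicate⁺)
open import Data.List.Relation.Unary.Linked using ([]; [-]; _∷_)
open import Data.List.Relation.Ternary.Interleaving using ([]; _∷ˡ_; _∷ʳ_)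
open import Data.List.Relation.Ternary.Interleaving.Propositional using (Interleaving)
open import Data.Product using (_,_)
open import Relation.Binary.PropositionalEquality using (refl; sym; cong; subst; module ≡-Reasoning)

∑≤∑∸1+n : ∀ {n} (f : Fin n → ℕ) → ∑ f ≤ ∑ (λ j → f j ∸ 1) + n
∑≤∑∸1+n {zero}  f = z≤n
∑≤∑∸1+n {suc n} f = begin
    f zero + ∑ (λ j → f (suc j))
  ≤⟨ +-mono-≤ (m≤n+m∸n (f zero) 1) (∑≤∑∸1+n (λ j → f (suc j))) ⟩
    (1 + (f zero ∸ 1)) + (∑ (λ j → f (suc j) ∸ 1) + n)
  ≡⟨ solve 3 (λ x s n → (con 1 :+ x) :+ (s :+ n) := (x :+ s) :+ (con 1 :+ n))
       refl (f zero ∸ 1) (∑ (λ j → f (suc j) ∸ 1)) n ⟩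
    (f zero ∸ 1) + ∑ (λ j → f (suc j) ∸ 1) + suc n
  ∎
  where open ≤-Reasoning
        open +-*-Solver

n≤∑-of-positive : ∀ {n} (f : Fin n → ℕ) → (∀ i → 1 ≤ f i) → n ≤ ∑ f
n≤∑-of-positive {zero}  f f≥1 = z≤n
n≤∑-of-positive {suc n} f f≥1 =
  +-mono-≤ (f≥1 zero) (n≤∑-of-positive (λ i → f (suc i)) (λ i → f≥1 (suc i)))

overfull⇒p≤TotMult : ∀ {p q} (m : BipMultigraph p q) →
                     (∀ i → q < degA m i) → p ≤ TotMult m
overfull⇒p≤TotMult {q = q} m overfull = n≤∑-of-positive _ row-has-multiple-edge
  where
    row-has-multiple-edge : ∀ i → 1 ≤ ∑ (λ j → m i j ∸ 1)
    row-has-multiple-edge i =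
      +-cancelʳ-< q 0 _ (<-≤-trans (overfull i) (∑≤∑∸1+n (m i)))

overfull⇒¬TotBigraphic : ∀ {t a b} → All (length b <_) a → t < length a →
                         ¬ TotBigraphic t a b
overfull⇒¬TotBigraphic {a = a} a>|b| t<|a| (m , degA≡a , _ , TotMult≤t) =
  <⇒≱ t<|a| (≤-trans (overfull⇒p≤TotMult m overfull) TotMult≤t)
  where
    overfull : ∀ i → _ < degA m i
    overfull i = subst (_ <_) (sym (degA≡a i)) (All.lookup a>|b| (∈-lookup i))

replicate-nonIncreasing : ∀ n x → NonIncreasing (replicate n x)
replicate-nonIncreasing zero          x = []
replicate-nonIncreasing (suc zero)    x = [-]
replicate-nonIncreasing (suc (suc n)) x = ≤-refl ∷ replicate-nonIncreasing (suc n) x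

replicate-interleaving : ∀ m n (x : ℕ) →
                         Interleaving (replicate m x) (replicate n x) (replicate (m + n) x)
replicate-interleaving zero    zero    x = []
replicate-interleaving zero    (suc n) x = refl ∷ʳ replicate-interleaving zero n x
replicate-interleaving (suc m) n       x = refl ∷ˡ replicate-interleaving m n x

sum-replicate : ∀ n x → sum (replicate n x) ≡ n * x
sum-replicate zero    x = refl
sum-replicate (suc n) x = cong (x +_) (sum-replicate n x)

lemma40 : (t : ℕ) → 1 ≤ t →
    Σ (List ℕ) λ d → Σ (List ℕ) λ a → Σ (List ℕ) λ b →
    DegreeSequence d × BP d a b × NonIncreasing a × NonIncreasing b ×
    Σ ℕ (λ a₁ → Σ (List ℕ) λ as → Σ ℕ λ b₁ → Σ (List ℕ) λ bs →
    (a ≡ a₁ ∷ as) × (b ≡ b₁ ∷ bs) ×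
    (a₁ * b₁ ≡ sum d / 2 + t + 2)) ×
    ¬ TotBigraphic t a b
lemma40 t _ =
  d , a , a ,
  (replicate-nonIncreasing (n + n) k , replicate⁺ (n + n) (s≤s z≤n) , divides (n * k) sum-d) ,
  (replicate-interleaving n n k , refl) ,
  replicate-nonIncreasing n k , replicate-nonIncreasing n k ,
  (k , replicate t k , k , replicate t k , refl , refl , k*k≡∑d/2+t+2) ,
  overfull⇒¬TotBigraphic (replicate⁺ n (subst (_< k) (sym (length-replicate n)) ≤-refl))
                         (subst (t <_) (sym (length-replicate n)) ≤-refl)
  where
    open ≡-Reasoning
    open +-*-Solver
    n k : ℕ
    n = suc t
    k = suc (suc t)
    a d : List ℕ
    a = replicate n k
    d = replicate (n + n) k

    sum-d : sum d ≡ n * k * 2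
    sum-d = begin
      sum d           ≡⟨ sum-replicate (n + n) k ⟩
      (n + n) * k     ≡⟨ solve 2 (λ n k → (n :+ n) :* k := n :* k :* con 2) refl n k ⟩
      n * k * 2       ∎

    k*k≡∑d/2+t+2 : k * k ≡ sum d / 2 + t + 2
    k*k≡∑d/2+t+2 = begin
      k * k                 ≡⟨ solve 1 (λ t → (con 2 :+ t) :* (con 2 :+ t)
                                            := (con 1 :+ t) :* (con 2 :+ t) :+ t :+ con 2) refl t ⟩
      n * k + t + 2         ≡⟨ cong (λ s → s + t + 2) (sym (m*n/n≡m (n * k) 2)) ⟩
      n * k * 2 / 2 + t + 2 ≡⟨ cong (λ s → s / 2 + t + 2) (sym sum-d) ⟩
      sum d / 2 + t + 2     ∎
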